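{- Let $t\in\mathbb{N}$, $k\in[h]$ and $i,j\in\{0,1,2,3\}$ with $|i-j|=1$ (modulo 4). If $\Delta r_i^k(t)=0$ then $V^k_{i,j}(t)=\varnothing$, and if $\Delta r_i^k(t)=1$ then $V^k_{j,i}(t)=\varnothing$.
   Context: Setting: $q\in\{1,2\}$, $h\in\mathbb{N}$, $[h]=\{1,\dots,h\}$, graph $G_1=(\mathbb{Z}\,\Box\,\mathbb{Z})\,\Box\,[h]$ or $G_2=(\mathbb{Z}\boxtimes\mathbb{Z})\,\Box\,[h]$ on vertex set $\mathbb{Z}^2\times[h]$ (in $G_1$: 4 horizontal nearest neighbours plus up/down; in $G_2$: 8 horizontal king-move neighbours plus up/down). Direction indices are taken mod 4. For $G_1$: $\theta_0=(\tfrac12,\tfrac12,0),\theta_1=(\tfrac12,-\tfrac12,0),\theta_2=(-\tfrac12,-\tfrac12,0),\theta_3=(-\tfrac12,\tfrac12,0)$; for $G_2$: $\theta_0=(0,1,0),\theta_1=(1,0,0),\theta_2=(0,-1,0),\theta_3=(-1,0,0)$; $\phi=(0,0,1)$. $L^k_{i,d}(a,b)=\{d\theta_i+m\theta_{i+1}+k\phi: m\in\mathbb{R},\,-a\le m<b\}\cap\mathbb{Z}^3$. For a set $U$ of vertices, $U^+$ is its closed neighbourhood in $G_q$. A vector $\vec x\in\mathbb{N}^h$ is Lipschitz if $|x^{k+1}-x^k|\le1$ for all $k\in[h-1]$; $\operatorname{lip}(\vec x)$ is the coordinatewise-minimal Lipschitz vector dominating $\vec x$ coordinatewise. Fronts structure: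 given Lipschitz vectors $\vec\rho_i(t)=(r_i^1(t),\dots,r_i^h(t))$, $i\in\{0,1,2,3\}$, set $L_i^k(t)=L^k_{i,r_i^k(t)}\big(r^k_{i-1}(t),r^k_{i+1}(t)\big)$. The vectors evolve as follows: $\vec\rho_i(0)$ are Lipschitz with all entries $\ge1$, and $\vec\rho_i(t)=\operatorname{lip}(\vec\rho_i(t-1)+\vec\alpha_i(t))$ where each $\vec\alpha_i(t)\in\{0,1\}^h$ is a Boolean activity vector (depending only on the history up to time $t-1$). Write $\Delta r_i^k(t)=r_i^k(t)-r_i^k(t-1)$ (which lies in $\{0,1\}$). Finally $V^k_{i,i-1}(t)=\big(L^k_{i-1}(t)\setminus L^k_{i-1}(t-1)\big)\cap L_i^k(t-1)$ and $V^k_{i,i+1}(t)=\big(L^k_{i+1}(t)\setminus L^k_{i+1}(t-1)\big)\cap\big(L_i^k(t-1)\big)^+$. -}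

module Defs where

open import Data.Nat as ℕ using (ℕ; zero; suc)
open import Data.Integer as ℤ using (ℤ; +_; -_; _*_; _+_)
open import Data.Fin using (Fin; zero; suc; toℕ)
open import Data.Bool using (Bool; true; false)
open import Data.Product using (_×_; _,_; ∃)
open import Data.Sum using (_⊎_)
open import Relation.Binary.PropositionalEquality using (_≡_)
open import Relation.Nullary using (¬_)

-- The two graphs G₁ = (ℤ □ ℤ) □ [h] and G₂ = (ℤ ⊠ ℤ) □ [h]

data Graph : Set where
  G₁ G₂ : Graph

-- Vertex set ℤ² × [h]; the layer k ∈ [h] = {1..h} is encoded as k-1 ∈ Fin h.
Vertex : ℕ → Set
Vertex h = ℤ × ℤ × Fin h

AbsDiff1 : ℤ → ℤ → Set
AbsDiff1 a b = (a ≡ b + + 1) ⊎ (b ≡ a + + 1)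

AbsDiff≤1 : ℤ → ℤ → Set
AbsDiff≤1 a b = (a ≡ b) ⊎ AbsDiff1 a b

AbsDiff1ℕ : ℕ → ℕ → Set
AbsDiff1ℕ a b = (a ≡ suc b) ⊎ (b ≡ suc a)

Adj : Graph → {h : ℕ} → Vertex h → Vertex h → Set
Adj G₁ (x , y , k) (x' , y' , k') =
    (k ≡ k' × ((AbsDiff1 x x' × y ≡ y') ⊎ (x ≡ x' × AbsDiff1 y y')))
  ⊎ (x ≡ x' × y ≡ y' × AbsDiff1ℕ (toℕ k) (toℕ k'))
Adj G₂ (x , y , k) (x' , y' , k') =
    (k ≡ k' × AbsDiff≤1 x x' × AbsDiff≤1 y y' × ¬ (x ≡ x' × y ≡ y'))
  ⊎ (x ≡ x' × y ≡ y' × AbsDiff1ℕ (toℕ k) (toℕ k'))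

VSet : ℕ → Set₁
VSet h = Vertex h → Set

closedNbhd : Graph → {h : ℕ} → VSet h → VSet h
closedNbhd q {h} U v = ∃ λ (u : Vertex h) → U u × (u ≡ v ⊎ Adj q u v)

_∖_ : {h : ℕ} → VSet h → VSet h → VSet h
(A ∖ B) v = A v × ¬ B v

_∩_ : {h : ℕ} → VSet h → VSet h → VSet h
(A ∩ B) v = A v × B v

IsEmpty : {h : ℕ} → VSet h → Set
IsEmpty {h} A = (v : Vertex h) → ¬ A v

next : Fin 4 → Fin 4
next zero = suc zero
next (suc zero) = suc (suc zero)
next (suc (suc zero)) = suc (suc (suc zero))
next (suc (suc (suc zero))) = zero

prev : Fin 4 → Fin 4
prev zero = suc (suc (suc zero))
prev (suc zero) = zero
prev (suc (suc zero)) = suc zero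
prev (suc (suc (suc zero))) = suc (suc zero)

-- scale s_q such that s_q · θ_i has integer coordinates:
-- for G₁ the θ_i have entries ±1/2, so we use 2θ_i; for G₂ the θ_i are integral.
scale : Graph → ℤ
scale G₁ = + 2
scale G₂ = + 1

-- horizontal part of s_q · θ_i  (the φ-component of θ_i is 0)
sθ : Graph → Fin 4 → ℤ × ℤ
sθ G₁ zero                   = (+ 1 , + 1)
sθ G₁ (suc zero)             = (+ 1 , - + 1)
sθ G₁ (suc (suc zero))       = (- + 1 , - + 1)
sθ G₁ (suc (suc (suc zero))) = (- + 1 , + 1)
sθ G₂ zero                   = (+ 0 , + 1)
sθ G₂ (suc zero)             = (+ 1 , + 0)
sθ G₂ (suc (suc zero))       = (+ 0 , - + 1)
sθ G₂ (suc (suc (suc zero))) = (- + 1 , + 0)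

xc yc : ℤ × ℤ → ℤ
xc (a , _) = a
yc (_ , b) = b

-- L^k_{i,d}(a,b) = {dθ_i + mθ_{i+1} + kφ : m ∈ ℝ, -a ≤ m < b} ∩ ℤ³.
-- A real m giving an integral point is necessarily an integer (θ_{i+1} has a
-- coordinate ±1/2 resp. ±1 and dθ_i has coordinates in ½ℤ resp. ℤ, with the
-- parities matching), so m ranges over ℤ; the defining equation is multiplied
-- by s_q to stay in ℤ.
Lset : Graph → {h : ℕ} → Fin 4 → Fin h → ℕ → ℕ → ℕ → VSet h
Lset q i k d a b (x , y , k') =
  k' ≡ k ×
  ∃ λ (m : ℤ) → (- (+ a) ℤ.≤ m) × (m ℤ.< + b)
    × (scale q * x ≡ + d * xc (sθ q i) + m * xc (sθ q (next i)))
    × (scale q * y ≡ + d * yc (sθ q i) + m * yc (sθ q (next i)))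

Lipschitz : {h : ℕ} → (Fin h → ℕ) → Set
Lipschitz {h} v = (k k' : Fin h) → toℕ k' ≡ suc (toℕ k) →
  (v k' ℕ.≤ suc (v k)) × (v k ℕ.≤ suc (v k'))

_≤v_ : {h : ℕ} → (Fin h → ℕ) → (Fin h → ℕ) → Set
x ≤v y = ∀ k → x k ℕ.≤ y k

-- IsLip x y  :⇔  y = lip(x), the coordinatewise-minimal Lipschitz vector dominating x
IsLip : {h : ℕ} → (Fin h → ℕ) → (Fin h → ℕ) → Set
IsLip {h} x y = Lipschitz y × x ≤v y
  × ((z : Fin h → ℕ) → Lipschitz z → x ≤v z → y ≤v z)

b2n : Bool → ℕ
b2n false = 0
b2n true  = 1

record Fronts (h : ℕ) : Set where
  field
    -- ρ i t k = r_i^{k}(t)   (layer k ∈ Fin h stands for k+1 ∈ [h])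
    ρ : Fin 4 → ℕ → Fin h → ℕ
    -- activity vectors α_i(t), used for t ≥ 1 (α i (suc t))
    α : Fin 4 → ℕ → Fin h → Bool
    ρ0-lip : ∀ i → Lipschitz (ρ i 0)
    ρ0-pos : ∀ i k → 1 ℕ.≤ ρ i 0 k
    ρ-step : ∀ i t → IsLip (λ k → ρ i t k ℕ.+ b2n (α i (suc t) k)) (ρ i (suc t))

module _ (q : Graph) {h : ℕ} (F : Fronts h) where
  open Fronts F

  Lf : Fin 4 → Fin h → ℕ → VSet h
  Lf i k t = Lset q i k (ρ i t k) (ρ (prev i) t k) (ρ (next i) t k)

  -- V^k_{i,j}(s+1) for j ∈ {i-1, i+1}  (defined only at times t = s+1 ≥ 1):
  --   V^k_{i,i-1}(t) = (L^k_{i-1}(t) ∖ L^k_{i-1}(t-1)) ∩ L^k_i(t-1)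
  --   V^k_{i,i+1}(t) = (L^k_{i+1}(t) ∖ L^k_{i+1}(t-1)) ∩ (L^k_i(t-1))⁺
  Vset : Fin 4 → Fin 4 → Fin h → ℕ → VSet h
  Vset i j k s v =
      (j ≡ prev i × ((Lf j k (suc s) ∖ Lf j k s) ∩ Lf i k s) v) ⊎
      (j ≡ next i × ((Lf j k (suc s) ∖ Lf j k s) ∩ closedNbhd q (Lf i k s)) v)

{-# OPTIONS --safe #-}
module Submission where

-- Scaled by s_q, the vectors θ_i and θ_{i+1} are orthogonal of squared length s_q, so
-- the point dθ_i + mθ_{i+1} + kφ of L^k_{i,d}(a,b) has coordinate d along s_qθ_i and
-- coordinate m ∈ [-a, b) along s_qθ_{i+1}.  Each claim then becomes a comparison of
-- coordinates, using that an edge of G_q changes every coordinate by at most one, that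
-- θ_{i+2} = -θ_i, and that the radii are non-decreasing and positive.  Three of the four
-- cases are immediate contradictions.  In the fourth, r_i stalls and a new point of
-- L_{i+1}(t) next to L_i(t-1) is seen to lie on the line d = r_{i+1}(t-1) with
-- non-positive θ_{i+2}-coordinate, so it already belonged to L_{i+1}(t-1).

open import Defs
open import Data.Nat as ℕ using (ℕ; suc; s≤s; z≤n)
import Data.Nat.Properties as ℕ
open import Data.Integer as ℤ
  using (ℤ; +_; -_; _+_; _-_; _*_; _≤_; _<_; 0ℤ; 1ℤ; -1ℤ; +≤+; -≤+; +<+; -<+)
open import Data.Integer.Properties
  using (*-cancelˡ-≡; +-identityˡ; +-identityʳ; +-inverseʳ; *-zeroʳ;
         ≤-trans; ≤-<-trans; <-irrefl; +-monoˡ-≤;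
         neg-mono-≤; neg-cancel-≤; drop‿+≤+; i<j⇒suc[i]≤j)
open import Data.Integer.Tactic.RingSolver using (solve; solve-∀)
open import Data.Fin using (Fin; zero; suc)
open import Data.List using (_∷_; [])
open import Data.Product using (_×_; _,_; proj₁; proj₂)
open import Data.Sum using (_⊎_; inj₁; inj₂)
open import Data.Empty using (⊥-elim)
open import Function using (_∘_)
open import Relation.Binary.PropositionalEquality
  using (_≡_; _≢_; refl; sym; trans; cong; cong₂; subst; module ≡-Reasoning)
open import Relation.Nullary using (¬_)

next-prev : ∀ i → next (prev i) ≡ i
next-prev zero                   = refl
next-prev (suc zero)             = refl
next-prev (suc (suc zero))       = refl
next-prev (suc (suc (suc zero))) = refl

prev-next : ∀ i → prev (next i) ≡ i
prev-next zero                   = refl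
prev-next (suc zero)             = refl
prev-next (suc (suc zero))       = refl
prev-next (suc (suc (suc zero))) = refl

prev≢next : ∀ i → prev i ≢ next i
prev≢next zero                   ()
prev≢next (suc zero)             ()
prev≢next (suc (suc zero))       ()
prev≢next (suc (suc (suc zero))) ()

next∘next≢id : ∀ i → i ≢ next (next i)
next∘next≢id zero                   ()
next∘next≢id (suc zero)             ()
next∘next≢id (suc (suc zero))       ()
next∘next≢id (suc (suc (suc zero))) ()

data ∣_∣≤1 : ℤ → Set where
  ∣-1∣≤1 : ∣ -1ℤ ∣≤1
  ∣0∣≤1  : ∣ 0ℤ ∣≤1
  ∣1∣≤1  : ∣ 1ℤ ∣≤1

∣∣≤1⇒≤1 : ∀ {a} → ∣ a ∣≤1 → a ≤ 1ℤ
∣∣≤1⇒≤1 ∣-1∣≤1 = -≤+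
∣∣≤1⇒≤1 ∣0∣≤1  = +≤+ z≤n
∣∣≤1⇒≤1 ∣1∣≤1  = +≤+ (s≤s z≤n)

∣*∣≤1 : ∀ {a b} → ∣ a ∣≤1 → ∣ b ∣≤1 → ∣ a * b ∣≤1
∣*∣≤1 ∣-1∣≤1 ∣-1∣≤1 = ∣1∣≤1
∣*∣≤1 ∣-1∣≤1 ∣0∣≤1  = ∣0∣≤1
∣*∣≤1 ∣-1∣≤1 ∣1∣≤1  = ∣-1∣≤1
∣*∣≤1 ∣0∣≤1  _      = ∣0∣≤1
∣*∣≤1 ∣1∣≤1  ∣-1∣≤1 = ∣-1∣≤1
∣*∣≤1 ∣1∣≤1  ∣0∣≤1  = ∣0∣≤1
∣*∣≤1 ∣1∣≤1  ∣1∣≤1  = ∣1∣≤1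

∣+∣≤1 : ∀ {a b} → ∣ a ∣≤1 → ∣ b ∣≤1 → a ≡ 0ℤ ⊎ b ≡ 0ℤ → ∣ a + b ∣≤1
∣+∣≤1 _   b≤1 (inj₁ refl) = subst ∣_∣≤1 (sym (+-identityˡ _)) b≤1
∣+∣≤1 a≤1 _   (inj₂ refl) = subst ∣_∣≤1 (sym (+-identityʳ _)) a≤1

≡⇒diff≡0 : ∀ {x y} → x ≡ y → y - x ≡ 0ℤ
≡⇒diff≡0 {x} refl = +-inverseʳ x

∣diff∣≤1 : ∀ {x y} → AbsDiff≤1 x y → ∣ y - x ∣≤1
∣diff∣≤1 (inj₁ x≡y) = subst ∣_∣≤1 (sym (≡⇒diff≡0 x≡y)) ∣0∣≤1
∣diff∣≤1 {y = y} (inj₂ (inj₁ refl)) = subst ∣_∣≤1 (sym (y-[y+1] y)) ∣-1∣≤1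
  where
  y-[y+1] : ∀ y → y - (y + 1ℤ) ≡ -1ℤ
  y-[y+1] = solve-∀
∣diff∣≤1 {x} (inj₂ (inj₂ refl)) = subst ∣_∣≤1 (sym ([x+1]-x x)) ∣1∣≤1
  where
  [x+1]-x : ∀ x → (x + 1ℤ) - x ≡ 1ℤ
  [x+1]-x = solve-∀

infix 7 _·_

_·_ : ℤ × ℤ → ℤ × ℤ → ℤ
(a , b) · (c , d) = a * c + b * d

sθ-norm : ∀ q i → sθ q i · sθ q i ≡ scale q
sθ-norm G₁ zero                   = refl
sθ-norm G₁ (suc zero)             = refl
sθ-norm G₁ (suc (suc zero))       = refl
sθ-norm G₁ (suc (suc (suc zero))) = refl
sθ-norm G₂ zero                   = refl
sθ-norm G₂ (suc zero)             = refl
sθ-norm G₂ (suc (suc zero))       = refl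
sθ-norm G₂ (suc (suc (suc zero))) = refl

sθ-orthogonal : ∀ q i → sθ q i · sθ q (next i) ≡ 0ℤ
sθ-orthogonal G₁ zero                   = refl
sθ-orthogonal G₁ (suc zero)             = refl
sθ-orthogonal G₁ (suc (suc zero))       = refl
sθ-orthogonal G₁ (suc (suc (suc zero))) = refl
sθ-orthogonal G₂ zero                   = refl
sθ-orthogonal G₂ (suc zero)             = refl
sθ-orthogonal G₂ (suc (suc zero))       = refl
sθ-orthogonal G₂ (suc (suc (suc zero))) = refl

sθ-antipodal : ∀ q i → sθ q (next (next i)) ≡ (- xc (sθ q i) , - yc (sθ q i))
sθ-antipodal G₁ zero                   = refl
sθ-antipodal G₁ (suc zero)             = refl
sθ-antipodal G₁ (suc (suc zero))       = refl
sθ-antipodal G₁ (suc (suc (suc zero))) = refl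
sθ-antipodal G₂ zero                   = refl
sθ-antipodal G₂ (suc zero)             = refl
sθ-antipodal G₂ (suc (suc zero))       = refl
sθ-antipodal G₂ (suc (suc (suc zero))) = refl

sθ-∣∣≤1 : ∀ q i → ∣ xc (sθ q i) ∣≤1 × ∣ yc (sθ q i) ∣≤1
sθ-∣∣≤1 G₁ zero                   = ∣1∣≤1 , ∣1∣≤1
sθ-∣∣≤1 G₁ (suc zero)             = ∣1∣≤1 , ∣-1∣≤1
sθ-∣∣≤1 G₁ (suc (suc zero))       = ∣-1∣≤1 , ∣-1∣≤1
sθ-∣∣≤1 G₁ (suc (suc (suc zero))) = ∣-1∣≤1 , ∣1∣≤1
sθ-∣∣≤1 G₂ zero                   = ∣0∣≤1 , ∣1∣≤1
sθ-∣∣≤1 G₂ (suc zero)             = ∣1∣≤1 , ∣0∣≤1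
sθ-∣∣≤1 G₂ (suc (suc zero))       = ∣0∣≤1 , ∣-1∣≤1
sθ-∣∣≤1 G₂ (suc (suc (suc zero))) = ∣-1∣≤1 , ∣0∣≤1

sθ-G₂-axis : ∀ i → xc (sθ G₂ i) ≡ 0ℤ ⊎ yc (sθ G₂ i) ≡ 0ℤ
sθ-G₂-axis zero                   = inj₁ refl
sθ-G₂-axis (suc zero)             = inj₂ refl
sθ-G₂-axis (suc (suc zero))       = inj₁ refl
sθ-G₂-axis (suc (suc (suc zero))) = inj₂ refl

scale-cancel : ∀ q {a b} → scale q * a ≡ scale q * b → a ≡ b
scale-cancel G₁ {a} {b} = *-cancelˡ-≡ (+ 2) a b
scale-cancel G₂ {a} {b} = *-cancelˡ-≡ (+ 1) a b

·-frame : ∀ {S x y d m} e f → e · e ≡ S → f · f ≡ S → e · f ≡ 0ℤ →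
  S * x ≡ d * xc e + m * xc f → S * y ≡ d * yc e + m * yc f →
  S * (e · (x , y)) ≡ S * d × S * (f · (x , y)) ≡ S * m
·-frame {S} {x} {y} {d} {m} (e₁ , e₂) (f₁ , f₂) e·e f·f e·f ex ey =
  (begin
    S * (e₁ * x + e₂ * y)                                ≡⟨ pull e₁ e₂ ⟩
    e₁ * (d * e₁ + m * f₁) + e₂ * (d * e₂ + m * f₂)
      ≡⟨ solve (d ∷ m ∷ e₁ ∷ e₂ ∷ f₁ ∷ f₂ ∷ []) ⟩
    d * (e₁ * e₁ + e₂ * e₂) + m * (e₁ * f₁ + e₂ * f₂)  ≡⟨ cong₂ (λ n o → d * n + m * o) e·e e·f ⟩
    d * S + m * 0ℤ                                      ≡⟨ solve (S ∷ d ∷ m ∷ []) ⟩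
    S * d                                               ∎) ,
  (begin
    S * (f₁ * x + f₂ * y)                                ≡⟨ pull f₁ f₂ ⟩
    f₁ * (d * e₁ + m * f₁) + f₂ * (d * e₂ + m * f₂)
      ≡⟨ solve (d ∷ m ∷ e₁ ∷ e₂ ∷ f₁ ∷ f₂ ∷ []) ⟩
    d * (e₁ * f₁ + e₂ * f₂) + m * (f₁ * f₁ + f₂ * f₂)  ≡⟨ cong₂ (λ n o → d * n + m * o) e·f f·f ⟩
    d * 0ℤ + m * S                                      ≡⟨ solve (S ∷ d ∷ m ∷ []) ⟩
    S * m                                               ∎)
  where
  open ≡-Reasoning
  pull : ∀ a b → S * (a * x + b * y) ≡ a * (d * e₁ + m * f₁) + b * (d * e₂ + m * f₂)
  pull a b = begin
    S * (a * x + b * y)          ≡⟨ solve (S ∷ a ∷ b ∷ x ∷ y ∷ []) ⟩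
    a * (S * x) + b * (S * y)    ≡⟨ cong₂ (λ sx sy → a * sx + b * sy) ex ey ⟩
    a * (d * e₁ + m * f₁) + b * (d * e₂ + m * f₂) ∎

·-negˡ : ∀ e w → (- xc e , - yc e) · w ≡ - (e · w)
·-negˡ (e₁ , e₂) (w₁ , w₂) = expand e₁ e₂ w₁ w₂
  where
  expand : ∀ a b c d → (- a) * c + (- b) * d ≡ - (a * c + b * d)
  expand = solve-∀

·-shift : ∀ e x y x₁ y₁ → e · (x₁ , y₁) ≡ (xc e * (x₁ - x) + yc e * (y₁ - y)) + e · (x , y)
·-shift (e₁ , e₂) = expand e₁ e₂
  where
  expand : ∀ a b x y x₁ y₁ → a * x₁ + b * y₁ ≡ (a * (x₁ - x) + b * (y₁ - y)) + (a * x + b * y)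
  expand = solve-∀

coord : Graph → Fin 4 → ∀ {h} → Vertex h → ℤ
coord q i (x , y , _) = sθ q i · (x , y)

coord-antipodal : ∀ q i {h} (v : Vertex h) → coord q (next (next i)) v ≡ - coord q i v
coord-antipodal q i (x , y , _) =
  trans (cong (_· (x , y)) (sθ-antipodal q i)) (·-negˡ (sθ q i) (x , y))

*-diff≡0 : ∀ a {x y} → x ≡ y → a * (y - x) ≡ 0ℤ
*-diff≡0 a x≡y = trans (cong (a *_) (≡⇒diff≡0 x≡y)) (*-zeroʳ a)

diff-∣∣≤1 : ∀ {a b x y x₁ y₁} → ∣ a ∣≤1 × ∣ b ∣≤1 → AbsDiff≤1 x x₁ → AbsDiff≤1 y y₁ →
  a * (x₁ - x) ≡ 0ℤ ⊎ b * (y₁ - y) ≡ 0ℤ → ∣ a * (x₁ - x) + b * (y₁ - y) ∣≤1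
diff-∣∣≤1 (a≤1 , b≤1) dx dy = ∣+∣≤1 (∣*∣≤1 a≤1 (∣diff∣≤1 dx)) (∣*∣≤1 b≤1 (∣diff∣≤1 dy))

step-∣∣≤1 : ∀ q i {h} {x y x₁ y₁ : ℤ} {k k₁ : Fin h} →
  (x , y , k) ≡ (x₁ , y₁ , k₁) ⊎ Adj q (x , y , k) (x₁ , y₁ , k₁) →
  ∣ xc (sθ q i) * (x₁ - x) + yc (sθ q i) * (y₁ - y) ∣≤1
step-∣∣≤1 q i {x = x} {y} (inj₁ refl) =
  diff-∣∣≤1 {x = x} {y = y} (sθ-∣∣≤1 q i) (inj₁ refl) (inj₁ refl) (inj₁ (*-diff≡0 (xc (sθ q i)) {x} refl))
step-∣∣≤1 G₁ i (inj₂ (inj₁ (_ , inj₁ (dx , ey)))) =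
  diff-∣∣≤1 (sθ-∣∣≤1 G₁ i) (inj₂ dx) (inj₁ ey) (inj₂ (*-diff≡0 (yc (sθ G₁ i)) ey))
step-∣∣≤1 G₁ i (inj₂ (inj₁ (_ , inj₂ (ex , dy)))) =
  diff-∣∣≤1 (sθ-∣∣≤1 G₁ i) (inj₁ ex) (inj₂ dy) (inj₁ (*-diff≡0 (xc (sθ G₁ i)) ex))
step-∣∣≤1 G₂ i (inj₂ (inj₁ (_ , dx , dy , _))) =
  diff-∣∣≤1 (sθ-∣∣≤1 G₂ i) dx dy (on-axis (sθ-G₂-axis i))
  where
  on-axis : ∀ {a b u v} → a ≡ 0ℤ ⊎ b ≡ 0ℤ → a * u ≡ 0ℤ ⊎ b * v ≡ 0ℤ
  on-axis (inj₁ refl) = inj₁ refl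
  on-axis (inj₂ refl) = inj₂ refl
step-∣∣≤1 G₁ i (inj₂ (inj₂ (ex , ey , _))) =
  diff-∣∣≤1 (sθ-∣∣≤1 G₁ i) (inj₁ ex) (inj₁ ey) (inj₁ (*-diff≡0 (xc (sθ G₁ i)) ex))
step-∣∣≤1 G₂ i (inj₂ (inj₂ (ex , ey , _))) =
  diff-∣∣≤1 (sθ-∣∣≤1 G₂ i) (inj₁ ex) (inj₁ ey) (inj₁ (*-diff≡0 (xc (sθ G₂ i)) ex))

coord-adjacent : ∀ q i {h} {u v : Vertex h} → u ≡ v ⊎ Adj q u v → coord q i v ≤ ℤ.suc (coord q i u)
coord-adjacent q i {u = x , y , k} {x₁ , y₁ , k₁} r = begin
  coord q i (x₁ , y₁ , k₁)
    ≡⟨ ·-shift (sθ q i) x y x₁ y₁ ⟩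
  (xc (sθ q i) * (x₁ - x) + yc (sθ q i) * (y₁ - y)) + coord q i (x , y , k)
    ≤⟨ +-monoˡ-≤ _ (∣∣≤1⇒≤1 (step-∣∣≤1 q i r)) ⟩
  ℤ.suc (coord q i (x , y , k)) ∎
  where open Data.Integer.Properties.≤-Reasoning

closedNbhd-coord-≤ : ∀ q i {h} {U : VSet h} {c v} → (∀ u → U u → coord q i u < c) →
  closedNbhd q U v → coord q i v ≤ c
closedNbhd-coord-≤ q i U<c (u , u∈U , u~v) =
  ≤-trans (coord-adjacent q i u~v) (i<j⇒suc[i]≤j (U<c u u∈U))

frame-coords : ∀ q i {x y d m} →
  scale q * x ≡ d * xc (sθ q i) + m * xc (sθ q (next i)) →
  scale q * y ≡ d * yc (sθ q i) + m * yc (sθ q (next i)) →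
  sθ q i · (x , y) ≡ d × sθ q (next i) · (x , y) ≡ m
frame-coords q i ex ey
  with ·-frame (sθ q i) (sθ q (next i)) (sθ-norm q i) (sθ-norm q (next i)) (sθ-orthogonal q i) ex ey
... | on-e , on-f = scale-cancel q on-e , scale-cancel q on-f

-- Lset matches on the vertex, so by η for pairs a membership proof has an unfolded type
-- from which the ℕ parameters of Lset cannot be recovered; they are passed explicitly.
module _ (q : Graph) {h : ℕ} {i : Fin 4} {k : Fin h} (d a b : ℕ) where

  Lset-coord : ∀ {v : Vertex h} → Lset q i k d a b v → coord q i v ≡ + d
  Lset-coord {x , y , _} (_ , m , _ , _ , ex , ey) = proj₁ (frame-coords q i {d = + d} {m} ex ey)

  Lset-coord-next : ∀ {v : Vertex h} → Lset q i k d a b v →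
    - (+ a) ≤ coord q (next i) v × coord q (next i) v < + b
  Lset-coord-next {x , y , _} (_ , m , lo , hi , ex , ey) =
    subst (- (+ a) ≤_) (sym m≡) lo , subst (_< + b) (sym m≡) hi
    where
    m≡ = proj₂ (frame-coords q i {d = + d} {m} ex ey)

  Lset-rebound : ∀ {a₁ b₁} {v : Vertex h} → Lset q i k d a b v →
    - (+ a₁) ≤ coord q (next i) v → coord q (next i) v < + b₁ → Lset q i k d a₁ b₁ v
  Lset-rebound {a₁} {b₁} {x , y , _} (k≡ , m , _ , _ , ex , ey) lo hi =
    k≡ , m , subst (- (+ a₁) ≤_) m≡ lo , subst (_< + b₁) m≡ hi , ex , ey
    where
    m≡ = proj₂ (frame-coords q i {d = + d} {m} ex ey)

module _ (q : Graph) {h : ℕ} {i : Fin 4} {k : Fin h} {v : Vertex h} where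

  Lset-end-disjoint : ∀ {d a b c e} → Lset q i k d a b v → ¬ Lset q (next i) k b c e v
  Lset-end-disjoint {d} {a} {b} {c} {e} p p₁ =
    <-irrefl (Lset-coord q b c e p₁) (proj₂ (Lset-coord-next q d a b p))

  Lset-start-disjoint : ∀ {a c e d b} → Lset q i k (suc a) c e v → ¬ Lset q (next i) k d a b v
  Lset-start-disjoint {a} {c} {e} {d} {b} p p₁ =
    ℕ.1+n≰n (drop‿+≤+ (neg-cancel-≤
      (subst (- (+ a) ≤_) opposite (proj₁ (Lset-coord-next q d a b p₁)))))
    where
    opposite : coord q (next (next i)) v ≡ - (+ suc a)
    opposite = trans (coord-antipodal q i v) (cong -_ (Lset-coord q (suc a) c e p))

  Lset-end-nbhd-disjoint : ∀ {d a b c e} → Lset q (next i) k (suc b) c e v →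
    ¬ closedNbhd q (Lset q i k d a b) v
  Lset-end-nbhd-disjoint {d} {a} {b} {c} {e} p nb =
    ℕ.1+n≰n (drop‿+≤+ (subst (_≤ + b) (Lset-coord q (suc b) c e p)
      (closedNbhd-coord-≤ q (next i) (λ _ → proj₂ ∘ Lset-coord-next q d a b) nb)))

  Lset-next-from-nbhd : ∀ {d d₁ a₁ a₂ b b₁ r c} → d ℕ.≤ d₁ → a₁ ℕ.≤ a₂ → 1 ℕ.≤ r → 1 ℕ.≤ b →
    Lset q (next i) k d₁ a₁ b₁ v → closedNbhd q (Lset q i k r c d) v → Lset q (next i) k d a₂ b v
  Lset-next-from-nbhd {d} {d₁} {a₁} {a₂} {b} {b₁} {r} {c} d≤d₁ a₁≤a₂ (s≤s z≤n) (s≤s z≤n) p nb =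
    Lset-rebound q d a₁ b₁ (subst (λ n → Lset q (next i) k n a₁ b₁ v) d₁≡d p) lower upper
    where
    d₁≡d : d₁ ≡ d
    d₁≡d = ℕ.≤-antisym
      (drop‿+≤+ (subst (_≤ + d) (Lset-coord q d₁ a₁ b₁ p)
        (closedNbhd-coord-≤ q (next i) (λ _ → proj₂ ∘ Lset-coord-next q r c d) nb)))
      d≤d₁

    lower : - (+ a₂) ≤ coord q (next (next i)) v
    lower = ≤-trans (neg-mono-≤ (+≤+ a₁≤a₂)) (proj₁ (Lset-coord-next q d₁ a₁ b₁ p))

    opposite-negative : ∀ u → Lset q i k r c d u → coord q (next (next i)) u < 0ℤ
    opposite-negative u pu =
      subst (_< 0ℤ) (sym (trans (coord-antipodal q i u) (cong -_ (Lset-coord q r c d pu)))) -<+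

    upper : coord q (next (next i)) v < + b
    upper = ≤-<-trans (closedNbhd-coord-≤ q (next (next i)) opposite-negative nb) (+<+ (s≤s z≤n))

module _ {h : ℕ} (F : Fronts h) where
  open Fronts F

  ρ-mono : ∀ i t k → ρ i t k ℕ.≤ ρ i (suc t) k
  ρ-mono i t k = ℕ.≤-trans (ℕ.m≤m+n _ _) (proj₁ (proj₂ (ρ-step i t)) k)

  ρ-pos : ∀ i t k → 1 ℕ.≤ ρ i t k
  ρ-pos i ℕ.zero    k = ρ0-pos i k
  ρ-pos i (suc t) k = ℕ.≤-trans (ρ-pos i t k) (ρ-mono i t k)

module _ (q : Graph) {h : ℕ} (F : Fronts h) (s : ℕ) (k : Fin h) where
  open Fronts F

  Stalls Advances : Fin 4 → Set
  Stalls   i = ρ i (suc s) k ≡ ρ i s k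
  Advances i = ρ i (suc s) k ≡ suc (ρ i s k)

  V-dichotomy : Fin 4 → Fin 4 → Set
  V-dichotomy i j =
    (Stalls i → IsEmpty (Vset q F i j k s)) × (Advances i → IsEmpty (Vset q F j i k s))

  Vset-next⊆ : ∀ {i v} → Vset q F i (next i) k s v →
    ((Lf q F (next i) k (suc s) ∖ Lf q F (next i) k s) ∩ closedNbhd q (Lf q F i k s)) v
  Vset-next⊆ {i} (inj₁ (next≡prev , _)) = ⊥-elim (prev≢next i (sym next≡prev))
  Vset-next⊆     (inj₂ (_ , v∈V))       = v∈V

  Vset-back⊆ : ∀ {i v} → Vset q F (next i) i k s v →
    ((Lf q F i k (suc s) ∖ Lf q F i k s) ∩ Lf q F (next i) k s) v
  Vset-back⊆     (inj₁ (_ , v∈V))  = v∈V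
  Vset-back⊆ {i} (inj₂ (i≡next² , _)) = ⊥-elim (next∘next≢id i i≡next²)

  private
    r : Fin 4 → ℕ → ℕ
    r i t = ρ i t k

  V-back-empty-if-next-stalls : ∀ i → Stalls (next i) → IsEmpty (Vset q F (next i) i k s)
  V-back-empty-if-next-stalls i stall v v∈V with Vset-back⊆ v∈V
  ... | (new , _) , old =
    Lset-end-disjoint q
      {d = r i (suc s)} {r (prev i) (suc s)} {r (next i) s} {r (prev (next i)) s} {r (next (next i)) s}
      (subst (λ b → Lset q i k (r i (suc s)) (r (prev i) (suc s)) b v) stall new) old

  V-next-empty-if-next-advances : ∀ i → Advances (next i) → IsEmpty (Vset q F i (next i) k s)
  V-next-empty-if-next-advances i adv v v∈V with Vset-next⊆ v∈V
  ... | (new , _) , near =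
    Lset-end-nbhd-disjoint q
      {d = r i s} {r (prev i) s} {r (next i) s} {r (prev (next i)) (suc s)} {r (next (next i)) (suc s)}
      (subst (λ d → Lset q (next i) k d (r (prev (next i)) (suc s)) (r (next (next i)) (suc s)) v) adv new)
      near

  V-next-empty-if-stalls : ∀ i → Stalls i → IsEmpty (Vset q F i (next i) k s)
  V-next-empty-if-stalls i stall v v∈V with Vset-next⊆ v∈V
  ... | (new , not-old) , near =
    not-old (Lset-next-from-nbhd q
      {d = r (next i) s} {r (next i) (suc s)} {r (prev (next i)) (suc s)} {r (prev (next i)) s}
      {r (next (next i)) s} {r (next (next i)) (suc s)} {r i s} {r (prev i) s}
      (ρ-mono F (next i) s k) (ℕ.≤-reflexive stall′) (ρ-pos F i s k) (ρ-pos F (next (next i)) s k)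
      new near)
    where
    stall′ : Stalls (prev (next i))
    stall′ = subst Stalls (sym (prev-next i)) stall

  V-back-empty-if-advances : ∀ i → Advances i → IsEmpty (Vset q F (next i) i k s)
  V-back-empty-if-advances i adv v v∈V with Vset-back⊆ v∈V
  ... | (new , _) , old =
    Lset-start-disjoint q
      {a = r i s} {r (prev i) (suc s)} {r (next i) (suc s)} {r (next i) s} {r (next (next i)) s}
      (subst (λ d → Lset q i k d (r (prev i) (suc s)) (r (next i) (suc s)) v) adv new)
      (subst (λ j → Lset q (next i) k (r (next i) s) (r j s) (r (next (next i)) s) v) (prev-next i) old)

  V-dichotomy-next : ∀ i → V-dichotomy i (next i)
  V-dichotomy-next i = V-next-empty-if-stalls i , V-back-empty-if-advances i

  V-dichotomy-prev : ∀ i → V-dichotomy i (prev i)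
  V-dichotomy-prev i = subst (λ i₁ → V-dichotomy i₁ (prev i)) (next-prev i)
    (V-back-empty-if-next-stalls (prev i) , V-next-empty-if-next-advances (prev i))

corollary3p5 : (q : Graph) (h : ℕ) (F : Fronts h) (s : ℕ) (k : Fin h) (i j : Fin 4) →
    (j ≡ prev i ⊎ j ≡ next i) →
    ((Fronts.ρ F i (suc s) k ≡ Fronts.ρ F i s k → IsEmpty (Vset q F i j k s))
     × (Fronts.ρ F i (suc s) k ≡ suc (Fronts.ρ F i s k) → IsEmpty (Vset q F j i k s)))
corollary3p5 q h F s k i _ (inj₁ refl) = V-dichotomy-prev q F s k i
corollary3p5 q h F s k i _ (inj₂ refl) = V-dichotomy-next q F s k i
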